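{- Let $P=NS^{\alpha_1}\cdots NS^{\alpha_n}$ be a Dyck path and let $T=\omega^{ -1}(P)$. Let $v_0$ be the root vertex of $T$ and $u_0,u_1,\dots,u_{n-1}$ its other vertices in clockwise order around $T$. Let $\beta_0,\dots,\beta_{n-1}\ge0$ be integers. Then the word obtained by making the tour of $T$ and writing $\mathbf S^{\beta_i}$ when arriving at the first corner of $u_i$ and $\mathbf N$ when arriving at the last corner of $u_i$ (for a leaf $u_i$, whose unique corner is both first and last, $\mathbf S^{\beta_i}$ is written before $\mathbf N$) is $\mathbf S^{\beta_0}\mathbf N^{\alpha_1}\mathbf S^{\beta_1}\mathbf N^{\alpha_2}\cdots\mathbf S^{\beta_{n-1}}\mathbf N^{\alpha_n}$.
   Context: A Dyck path of size $n$ is a word in $N$ ($+1$), $S$ ($-1$) with $n$ letters of each kind such that every prefix has at least as many $N$ as $S$; it is written uniquely $NS^{\alpha_1}\cdots NS^{\alpha_n}$. A plane tree is a tree embedded in the plane with a distinguished root corner at its root vertex. Its tour follows its border in clockwise direction starting and ending at the root corner, passing through the corners of each vertex in a certain order (hence a first and last corner of each vertex). $\omega(T)$ is the word obtained by writing $N$ the first time an edge is followed and $S$ the second time; $\omega$ is a bijection from plane trees with $n$ edges to Dyck paths of size $n$. The clockwise order of vertices is the order in which they are first encountered in the tour. $\mathbf N,\mathbf S$ are letters distinct from $N,S$. -}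

module Defs where

open import Data.Nat using (ℕ; zero; suc; pred; _≟_)
open import Data.List using (List; []; _∷_; _++_; [_]; replicate; concat; concatMap; map; reverse; deduplicate)
open import Data.List.Properties using (≡-dec)
open import Data.Vec using (Vec; toList)
open import Data.Product using (_×_; _,_; proj₁; proj₂)
open import Data.Maybe using (Maybe; just; nothing)
open import Data.Bool using (Bool; true; false; if_then_else_)
open import Relation.Nullary using (does)
open import Relation.Binary.PropositionalEquality using (_≡_)

data Letter : Set where
  N S : Letter

data BLetter : Set where
  𝐍 𝐒 : BLetter

data Tree : Set where
  node : List Tree → Tree

-- ω(T): N the first time an edge is followed (going down), S the second (going up).
mutual
  ω : Tree → List Letter
  ω (node ts) = ωs ts

  ωs : List Tree → List Letter
  ωs [] = []
  ωs (t ∷ ts) = N ∷ ω t ++ S ∷ ωs ts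

dyckWord : {n : ℕ} → Vec ℕ n → List Letter
dyckWord α = concatMap (λ a → N ∷ replicate a S) (toList α)

-- Vertices are addressed by their path from the root: the root is [],
-- and the j-th child (from 0, in clockwise order) of v is v ++ [ j ].
Vertex : Set
Vertex = List ℕ

-- Corners of a vertex v with d children: corner 0 is the corner preceding
-- the edge to child 0, corner k (1 ≤ k ≤ d) the corner following the edge
-- to child k-1.  (For the root, corner d is the root corner 0 again.)
-- An arrival = (vertex, corner) at which the tour arrives.
Arrival : Set
Arrival = Vertex × ℕ

-- The tour (clockwise, from the root corner), as the sequence of arrivals at corners.
mutual
  tourAt : Vertex → Tree → List Arrival
  tourAt v (node ts) = tourCh v 0 ts

  tourCh : Vertex → ℕ → List Tree → List Arrival
  tourCh v j [] = []
  tourCh v j (t ∷ ts) =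
    ((v ++ [ j ]) , 0) ∷ tourAt (v ++ [ j ]) t ++ ((v , suc j) ∷ tourCh v (suc j) ts)

tour : Tree → List Arrival
tour T = tourAt [] T

_≟V_ : (u v : Vertex) → Relation.Nullary.Dec (u ≡ v)
_≟V_ = ≡-dec _≟_

-- Vertices in clockwise order: order of first encounter in the tour, root first.
clockwise : Tree → List Vertex
clockwise T = deduplicate _≟V_ ([] ∷ map proj₁ (tour T))

posOf : Vertex → List Vertex → ℕ
posOf v [] = 0
posOf v (u ∷ us) = if does (u ≟V v) then 0 else suc (posOf v us)

firstArr : Vertex → List Arrival → Maybe ℕ
firstArr v [] = nothing
firstArr v ((u , k) ∷ as) = if does (u ≟V v) then just k else firstArr v as

firstCorner : Tree → Vertex → Maybe ℕ
firstCorner T v = firstArr v (tour T)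

lastCorner : Tree → Vertex → Maybe ℕ
lastCorner T v = firstArr v (reverse (tour T))

isJust≡ : Maybe ℕ → ℕ → Bool
isJust≡ (just m) k = does (m ≟ k)
isJust≡ nothing k = false

-- β_i for i < n (default 0 outside range, never used)
at : List ℕ → ℕ → ℕ
at [] i = 0
at (b ∷ bs) zero = b
at (b ∷ bs) (suc i) = at bs i

-- index i of a non-root vertex v = u_i (u_0, u_1, … the non-root vertices in clockwise order)
uIndex : Tree → Vertex → ℕ
uIndex T v = pred (posOf v (clockwise T))

emit : {n : ℕ} → Tree → Vec ℕ n → Arrival → List BLetter
emit T β ([] , k) = []
emit T β (v@(_ ∷ _) , k) =
  (if isJust≡ (firstCorner T v) k then replicate (at (toList β) (uIndex T v)) 𝐒 else [])
  ++ (if isJust≡ (lastCorner T v) k then [ 𝐍 ] else [])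

tourWord : {n : ℕ} → Tree → Vec ℕ n → List BLetter
tourWord T β = concatMap (emit T β) (tour T)

targetWord : {n : ℕ} → Vec ℕ n → Vec ℕ n → List BLetter
targetWord α β = Data.Vec.foldr _ (λ p w → replicate (proj₁ p) 𝐒 ++ replicate (proj₂ p) 𝐍 ++ w) [] (Data.Vec.zip β α)

module Submission where

-- A non-root vertex x is toured in one contiguous segment: the tour arrives at its first
-- corner, tours the subtrees of its children in order, and returns to its last corner.
-- Vertices are indexed in order of first arrival, so the index of x is the number of
-- non-root vertices met before it, i.e. the number of N read so far in ω(T).  Hence, by
-- induction on the tree, the segment of x writes 𝐒^{β_i}, then the letters of its children,
-- then 𝐍: the image of N ω(subtree) S under the substitution sending the i-th N to 𝐒^{β_i}
-- and every S to 𝐍.  Applied to ω(T) = N S^{α₁} ⋯ N S^{αₙ} this substitution gives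
-- 𝐒^{β₀} 𝐍^{α₁} ⋯ 𝐒^{β_{n-1}} 𝐍^{αₙ}.

open import Defs
open import Data.Nat using (ℕ; zero; suc; pred; _+_; _<_; _≤_; _≟_)
open import Data.Nat.Properties
  using ( +-suc; +-assoc; +-comm; +-identityʳ; m+1+n≢m; suc-injective
        ; <⇒≢; >⇒≢; <⇒≤; ≤-refl; m<n⇒m<1+n; n<1+n)
open import Data.List
  using (List; []; _∷_; _++_; [_]; replicate; concatMap; map; reverse; deduplicate; filter; length)
open import Data.List.Properties
  using ( ++-assoc; ++-identityʳ; ++-identityʳ-unique; ++-cancelˡ; ∷-injectiveˡ; map-++; reverse-++; reverse-map
        ; concatMap-++; length-++; filter-++; filter-all; filter-accept; filter-reject; filter-≐)
open import Data.List.Relation.Unary.All as All using (All; []; _∷_)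
open import Data.List.Relation.Unary.All.Properties using (++⁺; ++⁻ˡ; ++⁻ʳ)
open import Data.List.Relation.Unary.Any using (here; there)
import Data.List.Relation.Unary.Any.Properties as Any
open import Data.List.Membership.Propositional using (_∈_; _∉_)
open import Data.List.Membership.Propositional.Properties
  using (∈-map⁻; ∈-++⁺ˡ; ∈-++⁺ʳ; ∈-deduplicate⁻)
open import Data.List.Membership.DecPropositional _≟V_ using (_∉?_)
open import Data.Vec using (Vec; toList) renaming ([] to []ᵛ; _∷_ to _∷ᵛ_)
open import Data.Product using (_×_; _,_; proj₁; ∃)
open import Data.Sum using (_⊎_; inj₁; inj₂)
open import Data.Empty using (⊥-elim)
open import Data.Maybe using (Maybe; just)
open import Data.Bool using (true; false)
open import Data.Bool.Properties using (∧-zeroʳ)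
open import Function using (_∘_; _$_)
open import Relation.Nullary using (¬_; does; ¬?)
open import Relation.Nullary.Decidable using (dec-true; dec-false)
open import Relation.Unary using (Pred; Decidable; _≐_)
open import Relation.Unary.Properties using (_∩?_)
open import Relation.Binary.Definitions using (DecidableEquality)
open import Relation.Binary.PropositionalEquality
  using (_≡_; _≢_; refl; sym; trans; cong; cong₂; subst; module ≡-Reasoning)

open ≡-Reasoning

module _ {a} {A : Set a} where

  ++-regroup : ∀ (xs ys : List A) y zs → xs ++ (ys ++ y ∷ zs) ≡ ((xs ++ ys) ++ [ y ]) ++ zs
  ++-regroup xs ys y zs = sym (trans (++-assoc (xs ++ ys) [ y ] zs) (++-assoc xs ys (y ∷ zs)))

  filter-∩ : ∀ {p q} {P : Pred A p} {Q : Pred A q} (P? : Decidable P) (Q? : Decidable Q) xs →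
             filter P? (filter Q? xs) ≡ filter (P? ∩? Q?) xs
  filter-∩ P? Q? [] = refl
  filter-∩ P? Q? (x ∷ xs) with does (Q? x)
  ... | false rewrite ∧-zeroʳ (does (P? x)) = filter-∩ P? Q? xs
  ... | true with does (P? x)
  ...   | true  = cong (x ∷_) (filter-∩ P? Q? xs)
  ...   | false = filter-∩ P? Q? xs

  module _ (_≟ᴬ_ : DecidableEquality A) where

    open import Data.List.Membership.DecPropositional _≟ᴬ_ using () renaming (_∉?_ to _∉ᴬ?_)

    deduplicate-++ : ∀ xs ys → deduplicate _≟ᴬ_ (xs ++ ys) ≡
                     deduplicate _≟ᴬ_ xs ++ filter (_∉ᴬ? xs) (deduplicate _≟ᴬ_ ys)
    deduplicate-++ [] ys = sym (filter-all (_∉ᴬ? []) (All.tabulate (λ _ ())))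
    deduplicate-++ (x ∷ xs) ys = cong (x ∷_) (begin
      filter x≢? (deduplicate _≟ᴬ_ (xs ++ ys))
        ≡⟨ cong (filter x≢?) (deduplicate-++ xs ys) ⟩
      filter x≢? (deduplicate _≟ᴬ_ xs ++ filter (_∉ᴬ? xs) ys′)
        ≡⟨ filter-++ x≢? (deduplicate _≟ᴬ_ xs) _ ⟩
      filter x≢? (deduplicate _≟ᴬ_ xs) ++ filter x≢? (filter (_∉ᴬ? xs) ys′)
        ≡⟨ cong (filter x≢? (deduplicate _≟ᴬ_ xs) ++_)
             (trans (filter-∩ x≢? (_∉ᴬ? xs) ys′) (filter-≐ _ (_∉ᴬ? (x ∷ xs)) ∉-∷ ys′)) ⟩
      filter x≢? (deduplicate _≟ᴬ_ xs) ++ filter (_∉ᴬ? (x ∷ xs)) ys′ ∎)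
      where
      ys′ : List A
      ys′ = deduplicate _≟ᴬ_ ys
      x≢? : Decidable (λ z → ¬ x ≡ z)
      x≢? = ¬? ∘ (x ≟ᴬ_)
      ∉-∷ : (λ z → ¬ x ≡ z × z ∉ xs) ≐ (_∉ x ∷ xs)
      ∉-∷ = (λ { (x≢z , _) (here z≡x) → x≢z (sym z≡x) ; (_ , z∉xs) (there z∈xs) → z∉xs z∈xs })
          , λ z∉ → (λ x≡z → z∉ (here (sym x≡z))) , z∉ ∘ there

posOf-++-∉ : ∀ {v} us {vs} → v ∉ us → posOf v (us ++ v ∷ vs) ≡ length us
posOf-++-∉ {v} [] _ rewrite dec-true (v ≟V v) refl = refl
posOf-++-∉ {v} (u ∷ us) v∉ rewrite dec-false (u ≟V v) (λ u≡v → v∉ (here (sym u≡v))) =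
  cong suc (posOf-++-∉ us (v∉ ∘ there))

infix 4 _⊑_
_⊑_ : Vertex → Vertex → Set
u ⊑ v = ∃ λ r → u ++ r ≡ v

≡⇒⊑ : ∀ {u v} → u ≡ v → u ⊑ v
≡⇒⊑ {u} refl = [] , ++-identityʳ u

++⊑⇒⊑ : ∀ u {r v} → u ++ r ⊑ v → u ⊑ v
++⊑⇒⊑ u {r} (s , eq) = r ++ s , trans (sym (++-assoc u r s)) eq

child⋢parent : ∀ w {k} → ¬ (w ++ [ k ] ⊑ w)
child⋢parent w {k} (r , eq) with ++-identityʳ-unique w (sym (trans (sym (++-assoc w [ k ] r)) eq))
... | ()

siblings-disjoint : ∀ w {j k v} → j ≢ k → w ++ [ j ] ⊑ v → ¬ (w ++ [ k ] ⊑ v)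
siblings-disjoint w {j} {k} j≢k (r , eq) (s , eq′) =
  j≢k (∷-injectiveˡ (++-cancelˡ w (j ∷ r) (k ∷ s)
    (trans (sym (++-assoc w [ j ] r)) (trans eq (trans (sym eq′) (++-assoc w [ k ] s))))))

child≢root : ∀ (w : Vertex) {j} → w ++ [ j ] ≢ []
child≢root []      ()
child≢root (_ ∷ _) ()

-- Segments of the tour

vertices : List Arrival → List Vertex
vertices = map proj₁

subtreeTour : Vertex → Tree → List Arrival
subtreeTour x t = (x , 0) ∷ tourAt x t

mutual
  tourAt-below : ∀ x t → All (λ a → x ⊑ proj₁ a) (tourAt x t)
  tourAt-below x (node ts) = tourCh-below x 0 ts

  tourCh-below : ∀ w j ts → All (λ a → w ⊑ proj₁ a) (tourCh w j ts)
  tourCh-below w j [] = []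
  tourCh-below w j (t ∷ ts) =
    ++⁺ (All.map (++⊑⇒⊑ w) (subtreeTour-below (w ++ [ j ]) t))
        (≡⇒⊑ refl ∷ tourCh-below w (suc j) ts)

  subtreeTour-below : ∀ x t → All (λ a → x ⊑ proj₁ a) (subtreeTour x t)
  subtreeTour-below x t = ≡⇒⊑ refl ∷ tourAt-below x t

Unvisited : Vertex → List Arrival → Set
Unvisited x P = All (λ a → ¬ x ⊑ proj₁ a) P

unvisited⇒∉ : ∀ {x P} → Unvisited x P → x ∉ vertices P
unvisited⇒∉ x⋢P x∈P with ∈-map⁻ proj₁ x∈P
... | a , a∈P , x≡a = All.lookup x⋢P a∈P (≡⇒⊑ x≡a)

unvisited-extension : ∀ x {r P} → Unvisited x P → Unvisited (x ++ r) P
unvisited-extension x = All.map (λ x⋢ → x⋢ ∘ ++⊑⇒⊑ x)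

unvisited-parent : ∀ w {k c} → Unvisited (w ++ [ k ]) [ (w , c) ]
unvisited-parent w = child⋢parent w ∷ []

unvisited-sibling : ∀ w {j k} t → j ≢ k → Unvisited (w ++ [ k ]) (subtreeTour (w ++ [ j ]) t)
unvisited-sibling w t j≢k = All.map (siblings-disjoint w j≢k) (subtreeTour-below _ t)

unvisited-tourCh : ∀ w {j k} ts → k < j → Unvisited (w ++ [ k ]) (tourCh w j ts)
unvisited-tourCh w []       k<j = []
unvisited-tourCh w (t ∷ ts) k<j =
  ++⁺ (unvisited-sibling w t (>⇒≢ k<j)) (child⋢parent w ∷ unvisited-tourCh w ts (m<n⇒m<1+n k<j))

unvisited-afterChild : ∀ w {j k} P t → j < k → Unvisited (w ++ [ k ]) P →
                       Unvisited (w ++ [ k ]) ((P ++ subtreeTour (w ++ [ j ]) t) ++ [ (w , suc j) ])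
unvisited-afterChild w P t j<k ⋢P = ++⁺ (++⁺ ⋢P (unvisited-sibling w t (<⇒≢ j<k))) (unvisited-parent w)

firstArr-++-∉ : ∀ {v} A {B} → v ∉ vertices A → firstArr v (A ++ B) ≡ firstArr v B
firstArr-++-∉ [] _ = refl
firstArr-++-∉ {v} ((u , k) ∷ A) v∉ rewrite dec-false (u ≟V v) (λ u≡v → v∉ (here (sym u≡v))) =
  firstArr-++-∉ A (v∉ ∘ there)

firstArr-++-just : ∀ {v k} A {B} → firstArr v A ≡ just k → firstArr v (A ++ B) ≡ just k
firstArr-++-just {v} ((u , k) ∷ A) eq with does (u ≟V v)
... | true  = eq
... | false = firstArr-++-just A eq

firstArr-here : ∀ v {k} L → firstArr v ((v , k) ∷ L) ≡ just k
firstArr-here v _ rewrite dec-true (v ≟V v) refl = refl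

lastArr : Vertex → List Arrival → Maybe ℕ
lastArr v L = firstArr v (reverse L)

lastArr-++-∉ : ∀ {v} A B → v ∉ vertices B → lastArr v (A ++ B) ≡ lastArr v A
lastArr-++-∉ {v} A B v∉B = begin
  firstArr v (reverse (A ++ B))        ≡⟨ cong (firstArr v) (reverse-++ A B) ⟩
  firstArr v (reverse B ++ reverse A)  ≡⟨ firstArr-++-∉ (reverse B) (v∉B ∘ ∈-unreverse) ⟩
  firstArr v (reverse A)               ∎
  where
  ∈-unreverse : v ∈ vertices (reverse B) → v ∈ vertices B
  ∈-unreverse v∈ = Any.reverse⁻ (subst (v ∈_) (reverse-map proj₁ B) v∈)

lastArr-++-just : ∀ {v k} A B → lastArr v B ≡ just k → lastArr v (A ++ B) ≡ just k
lastArr-++-just {v} A B eq = trans (cong (firstArr v) (reverse-++ A B)) (firstArr-++-just (reverse B) eq)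

lastArr-tourCh : ∀ x j cs → lastArr x ((x , j) ∷ tourCh x j cs) ≡ just (j + length cs)
lastArr-tourCh x j [] = trans (firstArr-here x []) (cong just (sym (+-identityʳ j)))
lastArr-tourCh x j (c ∷ cs) =
  trans (lastArr-++-just ((x , j) ∷ subtreeTour (x ++ [ j ]) c) _ (lastArr-tourCh x (suc j) cs))
        (cong just (sym (+-suc j (length cs))))

Corners : Tree → Vertex → ℕ → Set
Corners T v d = firstCorner T v ≡ just 0 × lastCorner T v ≡ just d

corners-subtree : ∀ T {x} P Q cs → tour T ≡ P ++ subtreeTour x (node cs) ++ Q → Unvisited x (P ++ Q) →
                  Corners T x (length cs)
corners-subtree T {x} P Q cs split x⋢ = first , last
  where
  Sx : List Arrival
  Sx = subtreeTour x (node cs)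
  first : firstCorner T x ≡ just 0
  first = trans (cong (firstArr x) split)
                (trans (firstArr-++-∉ P (unvisited⇒∉ (++⁻ˡ P x⋢))) (firstArr-here x (tourAt x (node cs) ++ Q)))
  last : lastCorner T x ≡ just (length cs)
  last = begin
    lastArr x (tour T)          ≡⟨ cong (lastArr x) (trans split (sym (++-assoc P Sx Q))) ⟩
    lastArr x ((P ++ Sx) ++ Q)  ≡⟨ lastArr-++-∉ (P ++ Sx) Q (unvisited⇒∉ (++⁻ʳ P x⋢)) ⟩
    lastArr x (P ++ Sx)         ≡⟨ lastArr-++-just P Sx (lastArr-tourCh x 0 cs) ⟩
    just (length cs)            ∎

countN : List Letter → ℕ
countN []      = 0
countN (N ∷ u) = suc (countN u)
countN (S ∷ u) = countN u

countN-++ : ∀ u v → countN (u ++ v) ≡ countN u + countN v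
countN-++ []      v = refl
countN-++ (N ∷ u) v = cong suc (countN-++ u v)
countN-++ (S ∷ u) v = countN-++ u v

ωs-∷ : ∀ t ts → ωs (t ∷ ts) ≡ ωs [ t ] ++ ωs ts
ωs-∷ t ts = cong (N ∷_) (sym (++-assoc (ω t) [ S ] (ωs ts)))

translate : List ℕ → ℕ → List Letter → List BLetter
translate bs i []      = []
translate bs i (N ∷ u) = replicate (at bs i) 𝐒 ++ translate bs (suc i) u
translate bs i (S ∷ u) = 𝐍 ∷ translate bs i u

translate-++ : ∀ bs i u v → translate bs i (u ++ v) ≡ translate bs i u ++ translate bs (i + countN u) v
translate-++ bs i []      v = cong (λ m → translate bs m v) (sym (+-identityʳ i))
translate-++ bs i (S ∷ u) v = cong (𝐍 ∷_) (translate-++ bs i u v)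
translate-++ bs i (N ∷ u) v = begin
  𝐒ᵝ ++ translate bs (suc i) (u ++ v)
    ≡⟨ cong (𝐒ᵝ ++_) (translate-++ bs (suc i) u v) ⟩
  𝐒ᵝ ++ (translate bs (suc i) u ++ translate bs (suc i + countN u) v)
    ≡⟨ sym (++-assoc 𝐒ᵝ _ _) ⟩
  (𝐒ᵝ ++ translate bs (suc i) u) ++ translate bs (suc i + countN u) v
    ≡⟨ cong (λ m → (𝐒ᵝ ++ translate bs (suc i) u) ++ translate bs m v) (sym (+-suc i (countN u))) ⟩
  (𝐒ᵝ ++ translate bs (suc i) u) ++ translate bs (i + suc (countN u)) v ∎
  where
  𝐒ᵝ : List BLetter
  𝐒ᵝ = replicate (at bs i) 𝐒

translate-replicateS : ∀ bs i a u → translate bs i (replicate a S ++ u) ≡ replicate a 𝐍 ++ translate bs i u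
translate-replicateS bs i zero    u = refl
translate-replicateS bs i (suc a) u = cong (𝐍 ∷_) (translate-replicateS bs i a u)

translate-dyckWord : ∀ {n} (α β : Vec ℕ n) bs i → (∀ m → at bs (i + m) ≡ at (toList β) m) →
                     translate bs i (dyckWord α) ≡ targetWord α β
translate-dyckWord []ᵛ []ᵛ bs i _ = refl
translate-dyckWord (a ∷ᵛ α) (b ∷ᵛ β) bs i shift =
  cong₂ (λ c w → replicate c 𝐒 ++ w)
    (trans (cong (at bs) (sym (+-identityʳ i))) (shift 0))
    (trans (translate-replicateS bs (suc i) a (dyckWord α))
           (cong (replicate a 𝐍 ++_) (translate-dyckWord α β bs (suc i) shift′)))
  where
  shift′ : ∀ m → at bs (suc i + m) ≡ at (toList β) m
  shift′ m = trans (cong (at bs) (sym (+-suc i m))) (shift (suc m))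

-- Clockwise indices

met : List Arrival → List Vertex
met P = [] ∷ vertices P

visited : List Arrival → List Vertex
visited P = deduplicate _≟V_ (met P)

-- The next vertex met for the first time after the arrivals P is u_(rank P).
rank : List Arrival → ℕ
rank P = pred (length (visited P))

met-++ : ∀ P A → met (P ++ A) ≡ met P ++ vertices A
met-++ P A = cong ([] ∷_) (map-++ proj₁ P A)

∈-met-++⁺ˡ : ∀ {v} P A → v ∈ met P → v ∈ met (P ++ A)
∈-met-++⁺ˡ {v} P A v∈ = subst (v ∈_) (sym (met-++ P A)) (∈-++⁺ˡ v∈)

∈-met-snoc : ∀ {v k} P → v ∈ met (P ++ [ (v , k) ])
∈-met-snoc {v} {k} P = subst (v ∈_) (sym (met-++ P [ (v , k) ])) (∈-++⁺ʳ (met P) (here refl))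

unvisited⇒∉met : ∀ {x P} → x ≢ [] → Unvisited x P → x ∉ met P
unvisited⇒∉met x≢[] _   (here x≡[]) = x≢[] x≡[]
unvisited⇒∉met _    x⋢P (there x∈P) = unvisited⇒∉ x⋢P x∈P

visited-++ : ∀ P A → visited (P ++ A) ≡ visited P ++ filter (_∉? met P) (deduplicate _≟V_ (vertices A))
visited-++ P A = trans (cong (deduplicate _≟V_) (met-++ P A)) (deduplicate-++ _≟V_ (met P) (vertices A))

rank-snoc-met : ∀ P {v k} → v ∈ met P → rank (P ++ [ (v , k) ]) ≡ rank P
rank-snoc-met P {v} {k} v∈ = cong (pred ∘ length) (begin
  visited (P ++ [ (v , k) ])             ≡⟨ visited-++ P _ ⟩
  visited P ++ filter (_∉? met P) [ v ]  ≡⟨ cong (visited P ++_) (filter-reject (_∉? met P) (_$ v∈)) ⟩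
  visited P ++ []                        ≡⟨ ++-identityʳ (visited P) ⟩
  visited P                              ∎)

rank-snoc-new : ∀ P {v k} → v ∉ met P → rank (P ++ [ (v , k) ]) ≡ suc (rank P)
rank-snoc-new P {v} {k} v∉ = begin
  pred (length (visited (P ++ [ (v , k) ])))
    ≡⟨ cong (pred ∘ length) (visited-++ P _) ⟩
  pred (length (visited P ++ filter (_∉? met P) [ v ]))
    ≡⟨ cong (λ l → pred (length (visited P ++ l))) (filter-accept (_∉? met P) v∉) ⟩
  pred (length (visited P ++ [ v ]))
    ≡⟨ cong pred (length-++ (visited P)) ⟩
  rank P + 1
    ≡⟨ +-comm (rank P) 1 ⟩
  suc (rank P) ∎

uIndex-firstVisit : ∀ T {x k} P R → tour T ≡ P ++ (x , k) ∷ R → x ∉ met P → uIndex T x ≡ rank P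
uIndex-firstVisit T {x} P R split x∉ = cong pred (begin
  posOf x (visited (tour T))
    ≡⟨ cong (posOf x ∘ visited) split ⟩
  posOf x (visited (P ++ (x , _) ∷ R))
    ≡⟨ cong (posOf x) (visited-++ P _) ⟩
  posOf x (visited P ++ filter (_∉? met P) (deduplicate _≟V_ (x ∷ vertices R)))
    ≡⟨ cong (λ l → posOf x (visited P ++ l)) (filter-accept (_∉? met P) x∉) ⟩
  posOf x (visited P ++ x ∷ _)
    ≡⟨ posOf-++-∉ (visited P) (x∉ ∘ ∈-deduplicate⁻ _≟V_ (met P)) ⟩
  length (visited P) ∎)

mutual
  rank-subtree : ∀ {x} P t → x ≢ [] → Unvisited x P →
                 rank (P ++ subtreeTour x t) ≡ rank P + countN (ωs [ t ])
  rank-subtree {x} P (node cs) x≢[] x⋢P = begin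
    rank (P ++ (x , 0) ∷ tourCh x 0 cs)
      ≡⟨ cong rank (sym (++-assoc P [ (x , 0) ] _)) ⟩
    rank ((P ++ [ (x , 0) ]) ++ tourCh x 0 cs)
      ≡⟨ rank-forest (P ++ [ (x , 0) ]) cs (∈-met-snoc P) children⋢ ⟩
    rank (P ++ [ (x , 0) ]) + countN (ωs cs)
      ≡⟨ cong (_+ countN (ωs cs)) (rank-snoc-new P (unvisited⇒∉met x≢[] x⋢P)) ⟩
    suc (rank P + countN (ωs cs))
      ≡⟨ sym (+-suc (rank P) _) ⟩
    rank P + suc (countN (ωs cs))
      ≡⟨ cong (λ m → rank P + suc m) (sym (countN-++S (ωs cs))) ⟩
    rank P + countN (ωs [ node cs ]) ∎
    where
    children⋢ : ∀ {k} → 0 ≤ k → Unvisited (x ++ [ k ]) (P ++ [ (x , 0) ])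
    children⋢ _ = ++⁺ (unvisited-extension x x⋢P) (unvisited-parent x)
    countN-++S : ∀ u → countN (u ++ [ S ]) ≡ countN u
    countN-++S u = trans (countN-++ u [ S ]) (+-identityʳ (countN u))

  rank-afterChild : ∀ {w j} P t → w ∈ met P → Unvisited (w ++ [ j ]) P →
                    rank ((P ++ subtreeTour (w ++ [ j ]) t) ++ [ (w , suc j) ]) ≡ rank P + countN (ωs [ t ])
  rank-afterChild {w} {j} P t w∈ ⋢P =
    trans (rank-snoc-met (P ++ subtreeTour (w ++ [ j ]) t) (∈-met-++⁺ˡ P _ w∈))
          (rank-subtree P t (child≢root w) ⋢P)

  rank-forest : ∀ {w j} P ts → w ∈ met P → (∀ {k} → j ≤ k → Unvisited (w ++ [ k ]) P) →
                rank (P ++ tourCh w j ts) ≡ rank P + countN (ωs ts)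
  rank-forest P [] _ _ = trans (cong rank (++-identityʳ P)) (sym (+-identityʳ (rank P)))
  rank-forest {w} {j} P (t ∷ ts) w∈ later⋢ = begin
    rank (P ++ tourCh w j (t ∷ ts))
      ≡⟨ cong rank (++-regroup P (subtreeTour (w ++ [ j ]) t) _ _) ⟩
    rank (P′ ++ tourCh w (suc j) ts)
      ≡⟨ rank-forest P′ ts (∈-met-snoc (P ++ _)) later′ ⟩
    rank P′ + countN (ωs ts)
      ≡⟨ cong (_+ countN (ωs ts)) (rank-afterChild P t w∈ (later⋢ ≤-refl)) ⟩
    rank P + countN (ωs [ t ]) + countN (ωs ts)
      ≡⟨ +-assoc (rank P) _ _ ⟩
    rank P + (countN (ωs [ t ]) + countN (ωs ts))
      ≡⟨ cong (rank P +_) (sym (trans (cong countN (ωs-∷ t ts)) (countN-++ (ωs [ t ]) (ωs ts)))) ⟩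
    rank P + countN (ωs (t ∷ ts)) ∎
    where
    P′ : List Arrival
    P′ = (P ++ subtreeTour (w ++ [ j ]) t) ++ [ (w , suc j) ]
    later′ : ∀ {k} → suc j ≤ k → Unvisited (w ++ [ k ]) P′
    later′ j<k = unvisited-afterChild w P t j<k (later⋢ (<⇒≤ j<k))

-- The tour word

module _ (T : Tree) {n : ℕ} (β : Vec ℕ n) where

  private
    bs : List ℕ
    bs = toList β

    E : Arrival → List BLetter
    E = emit T β

  emit-leaf : ∀ {x} → x ≢ [] → Corners T x 0 → E (x , 0) ≡ replicate (at bs (uIndex T x)) 𝐒 ++ [ 𝐍 ]
  emit-leaf {[]}    x≢[] = ⊥-elim (x≢[] refl)
  emit-leaf {_ ∷ _} _ (first , last) rewrite first | last = refl

  emit-firstCorner : ∀ {x d} → x ≢ [] → Corners T x (suc d) → E (x , 0) ≡ replicate (at bs (uIndex T x)) 𝐒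
  emit-firstCorner {[]}    x≢[] = ⊥-elim (x≢[] refl)
  emit-firstCorner {_ ∷ _} _ (first , last) rewrite first | last = ++-identityʳ _

  emit-lastCorner : ∀ {x d} → x ≢ [] → Corners T x (suc d) → E (x , suc d) ≡ [ 𝐍 ]
  emit-lastCorner {[]}        x≢[] = ⊥-elim (x≢[] refl)
  emit-lastCorner {_ ∷ _} {d} _ (first , last) rewrite first | last | dec-true (suc d ≟ suc d) refl = refl

  emit-innerCorner : ∀ {w k m} → w ≡ [] ⊎ Corners T w (suc (k + suc m)) → E (w , suc k) ≡ []
  emit-innerCorner {[]}    _ = refl
  emit-innerCorner {_ ∷ _} {k} {m} (inj₂ (first , last))
    rewrite first | last | dec-false (suc (k + suc m) ≟ suc k) (m+1+n≢m k ∘ suc-injective) = refl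

  mutual
    word-subtree : ∀ {x} P Q t → tour T ≡ P ++ subtreeTour x t ++ Q → x ≢ [] → Unvisited x (P ++ Q) →
                   concatMap E (subtreeTour x t) ≡ translate bs (rank P) (ωs [ t ])
    word-subtree {x} P Q (node []) split x≢[] x⋢ =
      trans (++-identityʳ (E (x , 0)))
        (trans (emit-leaf x≢[] (corners-subtree T P Q [] split x⋢))
               (cong (λ i → replicate (at bs i) 𝐒 ++ [ 𝐍 ])
                     (uIndex-firstVisit T P _ split (unvisited⇒∉met x≢[] (++⁻ˡ P x⋢)))))
    word-subtree {x} P Q (node (c ∷ cs)) split x≢[] x⋢ = begin
      E (x , 0) ++ concatMap E (tourCh x 0 (c ∷ cs))
        ≡⟨ cong₂ _++_ (emit-firstCorner x≢[] corners)
                      (word-forest (P ++ [ (x , 0) ]) Q c cs split′ (∈-met-snoc P) children⋢ (inj₂ corners)) ⟩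
      𝐒ᵝ (uIndex T x) ++ (translate bs (rank (P ++ [ (x , 0) ])) (ωs (c ∷ cs)) ++ E (x , suc (length cs)))
        ≡⟨ cong₂ (λ i e → 𝐒ᵝ i ++ (translate bs (rank (P ++ [ (x , 0) ])) (ωs (c ∷ cs)) ++ e))
                 (uIndex-firstVisit T P _ split x∉P) (emit-lastCorner x≢[] corners) ⟩
      𝐒ᵝ (rank P) ++ (translate bs (rank (P ++ [ (x , 0) ])) (ωs (c ∷ cs)) ++ [ 𝐍 ])
        ≡⟨ cong (λ i → 𝐒ᵝ (rank P) ++ (translate bs i (ωs (c ∷ cs)) ++ [ 𝐍 ])) (rank-snoc-new P x∉P) ⟩
      𝐒ᵝ (rank P) ++ (translate bs (suc (rank P)) (ωs (c ∷ cs)) ++ [ 𝐍 ])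
        ≡⟨ cong (𝐒ᵝ (rank P) ++_) (sym (translate-++ bs (suc (rank P)) (ωs (c ∷ cs)) [ S ])) ⟩
      translate bs (rank P) (ωs [ node (c ∷ cs) ]) ∎
      where
      𝐒ᵝ : ℕ → List BLetter
      𝐒ᵝ i = replicate (at bs i) 𝐒
      x∉P : x ∉ met P
      x∉P = unvisited⇒∉met x≢[] (++⁻ˡ P x⋢)
      corners : Corners T x (length (c ∷ cs))
      corners = corners-subtree T P Q (c ∷ cs) split x⋢
      split′ : tour T ≡ (P ++ [ (x , 0) ]) ++ tourCh x 0 (c ∷ cs) ++ Q
      split′ = trans split (sym (++-assoc P [ (x , 0) ] _))
      children⋢ : ∀ {k} → 0 ≤ k → Unvisited (x ++ [ k ]) ((P ++ [ (x , 0) ]) ++ Q)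
      children⋢ _ = let x′⋢ = unvisited-extension x x⋢ in
        ++⁺ (++⁺ (++⁻ˡ P x′⋢) (unvisited-parent x)) (++⁻ʳ P x′⋢)

    -- The segment ends at the last corner of w, where w writes its own 𝐍 (the root writes nothing).
    word-forest : ∀ {w j} P Q t ts → tour T ≡ P ++ tourCh w j (t ∷ ts) ++ Q → w ∈ met P →
                  (∀ {k} → j ≤ k → Unvisited (w ++ [ k ]) (P ++ Q)) →
                  w ≡ [] ⊎ Corners T w (suc (j + length ts)) →
                  concatMap E (tourCh w j (t ∷ ts)) ≡
                  translate bs (rank P) (ωs (t ∷ ts)) ++ E (w , suc (j + length ts))
    word-forest {w} {j} P Q t [] split w∈ later⋢ corners = begin
      concatMap E (Sx ++ [ (w , suc j) ])
        ≡⟨ concatMap-++ E Sx _ ⟩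
      concatMap E Sx ++ (E (w , suc j) ++ [])
        ≡⟨ cong₂ _++_ (word-child P Q t [] split (later⋢ ≤-refl))
                      (trans (++-identityʳ _) (cong (λ d → E (w , suc d)) (sym (+-identityʳ j)))) ⟩
      translate bs (rank P) (ωs [ t ]) ++ E (w , suc (j + 0)) ∎
      where
      Sx : List Arrival
      Sx = subtreeTour (w ++ [ j ]) t
    word-forest {w} {j} P Q t (t′ ∷ ts) split w∈ later⋢ corners = begin
      concatMap E (Sx ++ (w , suc j) ∷ tourCh w (suc j) (t′ ∷ ts))
        ≡⟨ concatMap-++ E Sx _ ⟩
      concatMap E Sx ++ (E (w , suc j) ++ concatMap E (tourCh w (suc j) (t′ ∷ ts)))
        ≡⟨ cong₂ _++_ (word-child P Q t (t′ ∷ ts) split (later⋢ ≤-refl))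
             (cong₂ _++_ (emit-innerCorner corners)
                         (word-forest P′ Q t′ ts split′ (∈-met-snoc (P ++ Sx)) later′ corners′)) ⟩
      Wt ++ (translate bs (rank P′) (ωs (t′ ∷ ts)) ++ E (w , suc (suc j + length ts)))
        ≡⟨ cong₂ (λ i d → Wt ++ (translate bs i (ωs (t′ ∷ ts)) ++ E (w , suc d)))
                 (rank-afterChild P t w∈ (++⁻ˡ P (later⋢ ≤-refl))) (sym last≡) ⟩
      Wt ++ (translate bs (rank P + countN (ωs [ t ])) (ωs (t′ ∷ ts)) ++ lastE)
        ≡⟨ sym (++-assoc Wt _ lastE) ⟩
      (Wt ++ translate bs (rank P + countN (ωs [ t ])) (ωs (t′ ∷ ts))) ++ lastE
        ≡⟨ cong (_++ lastE) (sym (translate-++ bs (rank P) (ωs [ t ]) (ωs (t′ ∷ ts)))) ⟩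
      translate bs (rank P) (ωs [ t ] ++ ωs (t′ ∷ ts)) ++ lastE
        ≡⟨ cong (λ u → translate bs (rank P) u ++ lastE) (sym (ωs-∷ t (t′ ∷ ts))) ⟩
      translate bs (rank P) (ωs (t ∷ t′ ∷ ts)) ++ lastE ∎
      where
      Sx P′ : List Arrival
      Sx = subtreeTour (w ++ [ j ]) t
      P′ = (P ++ Sx) ++ [ (w , suc j) ]
      Wt lastE : List BLetter
      Wt = translate bs (rank P) (ωs [ t ])
      lastE = E (w , suc (j + suc (length ts)))
      last≡ : j + suc (length ts) ≡ suc (j + length ts)
      last≡ = +-suc j (length ts)
      corners′ : w ≡ [] ⊎ Corners T w (suc (suc j + length ts))
      corners′ = subst (λ d → w ≡ [] ⊎ Corners T w (suc d)) last≡ corners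
      split′ : tour T ≡ P′ ++ tourCh w (suc j) (t′ ∷ ts) ++ Q
      split′ = trans split (trans (cong (P ++_) (++-assoc Sx _ Q)) (++-regroup P Sx _ _))
      later′ : ∀ {k} → suc j ≤ k → Unvisited (w ++ [ k ]) (P′ ++ Q)
      later′ j<k = let ⋢ = later⋢ (<⇒≤ j<k) in
        ++⁺ (unvisited-afterChild w P t j<k (++⁻ˡ P ⋢)) (++⁻ʳ P ⋢)

    word-child : ∀ {w j} P Q t ts → tour T ≡ P ++ tourCh w j (t ∷ ts) ++ Q →
                 Unvisited (w ++ [ j ]) (P ++ Q) →
                 concatMap E (subtreeTour (w ++ [ j ]) t) ≡ translate bs (rank P) (ωs [ t ])
    word-child {w} {j} P Q t ts split ⋢ =
      word-subtree P ((w , suc j) ∷ tourCh w (suc j) ts ++ Q) t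
        (trans split (cong (P ++_) (++-assoc (subtreeTour (w ++ [ j ]) t) _ Q))) (child≢root w)
        (++⁺ (++⁻ˡ P ⋢) (child⋢parent w ∷ ++⁺ (unvisited-tourCh w ts (n<1+n j)) (++⁻ʳ P ⋢)))

tourWord-translate : ∀ T {n} (β : Vec ℕ n) → tourWord T β ≡ translate (toList β) 0 (ω T)
tourWord-translate (node [])       β = refl
tourWord-translate (node (t ∷ ts)) β =
  trans (word-forest (node (t ∷ ts)) β [] [] t ts (sym (++-identityʳ _)) (here refl) (λ _ → []) (inj₁ refl))
        (++-identityʳ _)

lemma3p7 : (n : ℕ) (α β : Vec ℕ n) (T : Tree) →
    ω T ≡ dyckWord α → tourWord T β ≡ targetWord α β
lemma3p7 n α β T ω≡ = begin
  tourWord T β                         ≡⟨ tourWord-translate T β ⟩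
  translate (toList β) 0 (ω T)         ≡⟨ cong (translate (toList β) 0) ω≡ ⟩
  translate (toList β) 0 (dyckWord α)  ≡⟨ translate-dyckWord α β (toList β) 0 (λ _ → refl) ⟩
  targetWord α β                       ∎
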